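{- Assume $\kappa:(R,\Sigma)\to(R',\Sigma')$ is measurable and realizable, with witness $\mathsf{tr}_\kappa : C\to C$ satisfying $\kappa^{\mathsf{M}}_{C}(e\cdot_{R'} c) = \mathsf{tr}_\kappa(e)\cdot_R c$ for all $e,c\in C$. Then for all predicates $\varphi',\psi' : C\to\Omega_{R'}$ and all $e\in C$, $$\mathcal{E\!F}_{R'} \vdash \varphi' \le_e \psi' \quad\Longrightarrow\quad \mathcal{E\!F}_{R} \vdash \kappa^*\varphi' \le_{\mathsf{tr}_\kappa(e)} \kappa^*\psi'.$$
   Context: For a tape space $(R,\Sigma)$ and countable $X$, $X_\bot=X\uplus\{\bot\}$ and $\mathsf{M}_R(X)$ is the set of measurable functions $R\to X_\bot$; truth values are $\Omega_R=(R\to[0,1])$ ordered pointwise. $C$ is a set of codes with applications $\cdot_R : C\times C\to\mathsf{M}_R(C)$ and $\cdot_{R'} : C\times C\to\mathsf{M}_{R'}(C)$ over the two tape spaces $(R,\Sigma)$ and $(R',\Sigma')$. The tape modality is $(\langle\Diamond x\leftarrow m\rangle\psi(x))(r)=0$ if $m(r)=\bot$ and $\psi(x)(r)$ if $m(r)=x$. $\mathcal{E\!F}_R$ (resp. $\mathcal{E\!F}_{R'}$) is the evidenced frame with propositions $C\to\Omega_R$, evidence codes in $C$, and entailment $\varphi\le_e\psi$ iff for all $c\in C$, $\varphi(c)\le\langle\Diamond a\leftarrow(e\cdot_R c)\rangle\psi(a)$ pointwise in the tape. For measurable $\kappa:R\to R'$, reindexing is by precomposition: $(\kappa^{\mathsf{M}}_{C}(m))(r)=m(\kappa(r))$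 for $m\in\mathsf{M}_{R'}(C)$, $(\kappa^{\Omega}(\alpha))(r)=\alpha(\kappa(r))$ for $\alpha\in\Omega_{R'}$, and for $\varphi':C\to\Omega_{R'}$, $(\kappa^*\varphi')(c)=\kappa^{\Omega}(\varphi'(c))$. -}

module Defs where

open import Level using (0ℓ)
open import Data.Nat using (ℕ)
open import Data.Unit using (⊤)
open import Data.Product using (∃; _×_)
open import Data.Maybe using (Maybe; just; nothing)
open import Relation.Nullary using (¬_)
open import Relation.Binary.PropositionalEquality using (_≡_)
open import Relation.Binary.Structures using (IsPartialOrder)
open import Function.Bundles using (_↣_)

record MeasurableSpace : Set₁ where
  field
    Carrier    : Set
    Measurable : (Carrier → Set) → Set
    meas-full  : Measurable (λ _ → ⊤)
    meas-compl : ∀ {A} → Measurable A → Measurable (λ r → ¬ A r)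
    meas-union : (A : ℕ → Carrier → Set) → (∀ n → Measurable (A n)) →
                 Measurable (λ r → ∃ λ n → A n r)
open MeasurableSpace public

Countable : Set → Set
Countable X = X ↣ ℕ

IsMeasurableMap : (R R' : MeasurableSpace) → (Carrier R → Carrier R') → Set₁
IsMeasurableMap R R' κ =
  ∀ (A : Carrier R' → Set) → Measurable R' A → Measurable R (λ r → A (κ r))

-- M_R(X): measurable functions R → X_⊥ (X countable, discrete σ-algebra on X_⊥;
-- X_⊥ is represented as Maybe X, with nothing = ⊥).
record M (R : MeasurableSpace) (X : Set) : Set where
  constructor mkM
  field
    run  : Carrier R → Maybe X
    meas : ∀ (x : Maybe X) → Measurable R (λ r → run r ≡ x)
open M public

-- Abstract unit interval [0,1] with its order and least element 0
-- (only the order and 0 are used by the notions below).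
record UnitInterval : Set₁ where
  field
    I          : Set
    _≤I_       : I → I → Set
    0I         : I
    1I         : I
    isPO       : IsPartialOrder _≡_ _≤I_
    0-least    : ∀ x → 0I ≤I x
    1-greatest : ∀ x → x ≤I 1I
open UnitInterval public

module _ (U : UnitInterval) (R : MeasurableSpace) where

  Ω : Set
  Ω = Carrier R → I U

  _≤Ω_ : Ω → Ω → Set
  α ≤Ω β = ∀ r → _≤I_ U (α r) (β r)

  diamond : {C : Set} → M R C → (C → Ω) → Ω
  diamond m ψ r with run m r
  ... | nothing = 0I U
  ... | just x  = ψ x r

  Entails : {C : Set} → (C → C → M R C) → (C → Ω) → C → (C → Ω) → Set
  Entails app φ e ψ = ∀ (c : _) → φ c ≤Ω diamond (app e c) (λ a → ψ a)

κM : (R R' : MeasurableSpace) {C : Set} (κ : Carrier R → Carrier R') →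
     IsMeasurableMap R R' κ → M R' C → M R C
κM R R' κ κmeas m = mkM (λ r → run m (κ r)) (λ x → κmeas _ (meas m x))

κΩ : (U : UnitInterval) (R R' : MeasurableSpace) (κ : Carrier R → Carrier R') →
     Ω U R' → Ω U R
κΩ U R R' κ α r = α (κ r)

κ* : (U : UnitInterval) (R R' : MeasurableSpace) {C : Set} (κ : Carrier R → Carrier R') →
     (C → Ω U R') → (C → Ω U R)
κ* U R R' κ φ c = κΩ U R R' κ (φ c)

{-# OPTIONS --safe #-}
module Submission where

open import Defs
open import Data.Maybe using (just; nothing)
open import Relation.Binary.PropositionalEquality using (_≡_; refl; subst)

-- The tape modality is computed pointwise from the tape, and reindexing is
-- precomposition with κ, so a realizer for κ-reindexed applications turns
-- the pointwise inequalities over R' into the same inequalities over R.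

module _ (U : UnitInterval) where

  diamond-cong-run : (R : MeasurableSpace) {C : Set} (m n : M R C) (ψ : C → Ω U R)
    (r : Carrier R) → run m r ≡ run n r → diamond U R m ψ r ≡ diamond U R n ψ r
  diamond-cong-run R m n ψ r p with run m r | run n r | p
  ... | nothing | nothing | refl = refl
  ... | just x  | just .x | refl = refl

  diamond-reindex : (R R' : MeasurableSpace) {C : Set} (κ : Carrier R → Carrier R')
    (κmeas : IsMeasurableMap R R' κ) (m : M R' C) (ψ : C → Ω U R') (r : Carrier R) →
    diamond U R' m ψ (κ r) ≡ diamond U R (κM R R' κ κmeas m) (κ* U R R' κ ψ) r
  diamond-reindex R R' κ κmeas m ψ r with run m (κ r)
  ... | nothing = refl
  ... | just x  = refl

  Entails-reindex : (R R' : MeasurableSpace) {C : Set} (κ : Carrier R → Carrier R')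
    (κmeas : IsMeasurableMap R R' κ) (app' : C → C → M R' C) (φ' ψ' : C → Ω U R') (e : C) →
    Entails U R' app' φ' e ψ' →
    Entails U R (λ e c → κM R R' κ κmeas (app' e c)) (κ* U R R' κ φ') e (κ* U R R' κ ψ')
  Entails-reindex R R' κ κmeas app' φ' ψ' e φ'≤ψ' c r =
    subst (_≤I_ U (φ' c (κ r))) (diamond-reindex R R' κ κmeas (app' e c) ψ' r) (φ'≤ψ' c (κ r))

  Entails-resp-run : (R : MeasurableSpace) {C : Set} (app₁ app₂ : C → C → M R C)
    (φ ψ : C → Ω U R) (e₁ e₂ : C) →
    (∀ c r → run (app₁ e₁ c) r ≡ run (app₂ e₂ c) r) →
    Entails U R app₁ φ e₁ ψ → Entails U R app₂ φ e₂ ψ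
  Entails-resp-run R app₁ app₂ φ ψ e₁ e₂ same-run φ≤ψ c r =
    subst (_≤I_ U (φ c r)) (diamond-cong-run R (app₁ e₁ c) (app₂ e₂ c) ψ r (same-run c r))
      (φ≤ψ c r)

theorem15 : (U : UnitInterval) (R R' : MeasurableSpace) (C : Set) → Countable C →
    (appR : C → C → M R C) (appR' : C → C → M R' C) →
    (κ : Carrier R → Carrier R') (κmeas : IsMeasurableMap R R' κ) →
    (tr : C → C) →
    (∀ e c r → run (κM R R' κ κmeas (appR' e c)) r ≡ run (appR (tr e) c) r) →
    (φ' ψ' : C → Ω U R') (e : C) →
    Entails U R' appR' φ' e ψ' →
    Entails U R appR (κ* U R R' κ φ') (tr e) (κ* U R R' κ ψ')
theorem15 U R R' C _ appR appR' κ κmeas tr tr-realizes φ' ψ' e φ'≤ψ' =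
  Entails-resp-run U R (λ e c → κM R R' κ κmeas (appR' e c)) appR
    (κ* U R R' κ φ') (κ* U R R' κ ψ') e (tr e) (tr-realizes e)
    (Entails-reindex U R R' κ κmeas appR' φ' ψ' e φ'≤ψ')
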